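{- For every GPT-model $\mathcal{M} = (X, \leq, R, S, V)$ there is a strictly condensed GPT-model $\mathcal{M}^+ = (X, \leq, R^+, S^+, V)$ with the same underlying intuitionistic Kripke model $(X,\leq,V)$ such that for all $x \in X$ and all tense bi-intuitionistic formulae $\phi$: $\mathcal{M}, x \Vdash \phi \iff \mathcal{M}^+, x \Vdash \phi$. (One may take $R^+ = ({\leq} \circ R)$ and $S^+ = (S \circ {\geq})$.)
   Context: Tense bi-intuitionistic formulae are built from propositional variables, $\top,\bot,\wedge,\vee$, intuitionistic implication $\to$, subtraction $\phi \mathbin{ -\!\!<} \psi$, and four unary modalities $\Box$, $\Diamond$, a tense box $\Box^{ - }$ and a tense diamond $\Diamond^{ - }$. For relations $Z,Z'$ on $X$, $Z \circ Z' = \{(x,y) \mid \exists u.\, xZu \text{ and } uZ'y\}$, and $\breve{Z}$ is the converse of $Z$. An intuitionistic Kripke model $(X,\leq,V)$ is a preorder with an upset-valued valuation; $x \Vdash \phi \to \psi$ iff every $y \geq x$ satisfying $\phi$ satisfies $\psi$, and $x \Vdash \phi \mathbin{ -\!\!<} \psi$ iff some $y \leq x$ satisfies $\phi$ and not $\psi$; other propositional connectives are as usual. A GPT-model is a tuple $(X,\leq,R,S,V)$ with $(X,\leq,V)$ an intuitionistic Kripke model and $R,S \subseteq X\times X$ satisfying $(R \circ {\leq}) \subseteq ({\leq} \circ R)$ and $({\geq} \circ S) \subseteq (S \circ {\geq})$. The modalities are interpreted by: $x \Vdash \Box\phi$ iff for all $y$ with $x({\leq}\circ R)y$, $y \Vdash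 \phi$; $x \Vdash \Diamond\phi$ iff there is $y$ with $xSy$ and $y\Vdash\phi$; $x \Vdash \Box^{ - }\phi$ iff for all $y$ with $x({\leq}\circ \breve{S})y$, $y\Vdash\phi$; $x\Vdash \Diamond^{ - }\phi$ iff there is $y$ with $x\breve{R}y$ and $y\Vdash\phi$. A GPT-model is strictly condensed if $({\leq} \circ R) \subseteq R$ and $({\leq} \circ \breve{S}) \subseteq \breve{S}$. -}

module Defs where

open import Level using (Level; _⊔_; suc)
open import Data.Nat using (ℕ)
open import Data.Product using (Σ; _×_; ∃)
open import Data.Unit.Polymorphic using (⊤)
open import Data.Empty.Polymorphic using (⊥)
open import Data.Sum using (_⊎_)
open import Relation.Nullary using (¬_)
open import Relation.Binary using (IsPreorder; Rel)
open import Relation.Binary.PropositionalEquality using (_≡_)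

data Form : Set where
  var  : ℕ → Form
  ⊤f ⊥f : Form
  _∧f_ _∨f_ _⇒f_ _−<_ : Form → Form → Form
  □f ◇f □⁻ ◇⁻ : Form → Form

_⨾_ : ∀ {a r s} {X : Set a} → Rel X r → Rel X s → Rel X (a ⊔ r ⊔ s)
(Z ⨾ Z') x y = ∃ λ u → Z x u × Z' u y

conv : ∀ {a r} {X : Set a} → Rel X r → Rel X r
conv Z x y = Z y x

_⊆ʳ_ : ∀ {a r s} {X : Set a} → Rel X r → Rel X s → Set (a ⊔ r ⊔ s)
Z ⊆ʳ Z' = ∀ {x y} → Z x y → Z' x y

record KripkeModel (a r v : Level) : Set (suc (a ⊔ r ⊔ v)) where
  field
    X         : Set a
    _≤_       : Rel X r
    isPreorder : IsPreorder _≡_ _≤_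
    V         : ℕ → X → Set v
    V-upset   : ∀ p {x y} → x ≤ y → V p x → V p y

  _≥_ : Rel X r
  _≥_ = conv _≤_

record GPTModel (a r v m : Level) : Set (suc (a ⊔ r ⊔ v ⊔ m)) where
  field
    K : KripkeModel a r v
  open KripkeModel K public
  field
    R S : Rel X m
    R-cond : (R ⨾ _≤_) ⊆ʳ (_≤_ ⨾ R)
    S-cond : (_≥_ ⨾ S) ⊆ʳ (S ⨾ _≥_)

  _⊩_ : X → Form → Set (a ⊔ r ⊔ v ⊔ m)
  x ⊩ var p   = Level.Lift (a ⊔ r ⊔ m) (V p x)
  x ⊩ ⊤f      = ⊤
  x ⊩ ⊥f      = ⊥
  x ⊩ (φ ∧f ψ) = (x ⊩ φ) × (x ⊩ ψ)
  x ⊩ (φ ∨f ψ) = (x ⊩ φ) ⊎ (x ⊩ ψ)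
  x ⊩ (φ ⇒f ψ) = ∀ y → x ≤ y → y ⊩ φ → y ⊩ ψ
  x ⊩ (φ −< ψ) = ∃ λ y → y ≤ x × (y ⊩ φ) × ¬ (y ⊩ ψ)
  x ⊩ □f φ    = ∀ y → (_≤_ ⨾ R) x y → y ⊩ φ
  x ⊩ ◇f φ    = ∃ λ y → S x y × (y ⊩ φ)
  x ⊩ □⁻ φ    = ∀ y → (_≤_ ⨾ conv S) x y → y ⊩ φ
  x ⊩ ◇⁻ φ    = ∃ λ y → conv R x y × (y ⊩ φ)

  StrictlyCondensed : Set (a ⊔ r ⊔ m)
  StrictlyCondensed = ((_≤_ ⨾ R) ⊆ʳ R) × ((_≤_ ⨾ conv S) ⊆ʳ conv S)

withRelations : ∀ {a r v m m'} (M : GPTModel a r v m) →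
  (R⁺ S⁺ : Rel (GPTModel.X M) m') →
  (R⁺ ⨾ GPTModel._≤_ M) ⊆ʳ (GPTModel._≤_ M ⨾ R⁺) →
  (GPTModel._≥_ M ⨾ S⁺) ⊆ʳ (S⁺ ⨾ GPTModel._≥_ M) →
  GPTModel a r v m'
withRelations M R⁺ S⁺ Rc Sc =
  record { K = GPTModel.K M ; R = R⁺ ; S = S⁺ ; R-cond = Rc ; S-cond = Sc }

-- The boxes of M already quantify along ≤ ⨾ R and ≤ ⨾ conv S, which absorb a
-- further ≤ on the left by transitivity, so they are unchanged in M⁺. A diamond
-- of M⁺ reaches points lying above an S- (resp. below an R-) successor, where
-- the formula still holds because truth is persistent along ≤; persistence of
-- the diamonds is exactly where the frame conditions on R and S are used.
module Submission where

open import Defs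
open import Level using (Level; _⊔_; lift)
open import Data.Product using (Σ; _×_; _,_)
open import Data.Sum using (inj₁; inj₂)
open import Relation.Binary using (Rel; IsPreorder)
open import Function.Bundles using (_⇔_; mk⇔)

module Persistence {a r v m : Level} (M : GPTModel a r v m) where
  open GPTModel M
  open IsPreorder isPreorder using (trans)

  ⊩-upset : ∀ φ {x y} → x ≤ y → x ⊩ φ → y ⊩ φ
  ⊩-upset (var p)  x≤y (lift Vx)       = lift (V-upset p x≤y Vx)
  ⊩-upset ⊤f       x≤y _               = _
  ⊩-upset (φ ∧f ψ) x≤y (xφ , xψ)       = ⊩-upset φ x≤y xφ , ⊩-upset ψ x≤y xψ
  ⊩-upset (φ ∨f ψ) x≤y (inj₁ xφ)       = inj₁ (⊩-upset φ x≤y xφ)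
  ⊩-upset (φ ∨f ψ) x≤y (inj₂ xψ)       = inj₂ (⊩-upset ψ x≤y xψ)
  ⊩-upset (φ ⇒f ψ) x≤y x⊩φ⇒ψ = λ z y≤z → x⊩φ⇒ψ z (trans x≤y y≤z)
  ⊩-upset (φ −< ψ) x≤y (z , z≤x , zφ , z⊮ψ) = z , trans z≤x x≤y , zφ , z⊮ψ
  ⊩-upset (□f φ)   x≤y x□φ z (u , y≤u , uRz) = x□φ z (u , trans x≤y y≤u , uRz)
  ⊩-upset (□⁻ φ)   x≤y x□φ z (u , y≤u , zSu) = x□φ z (u , trans x≤y y≤u , zSu)
  ⊩-upset (◇f φ) {x} x≤y (z , xSz , zφ) with S-cond (x , x≤y , xSz)
  ... | u , ySu , z≤u = u , ySu , ⊩-upset φ z≤u zφ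
  ⊩-upset (◇⁻ φ) {x} x≤y (z , zRx , zφ) with R-cond (x , zRx , x≤y)
  ... | u , z≤u , uRy = u , uRy , ⊩-upset φ z≤u zφ

module Condensation {a r v m : Level} (M : GPTModel a r v m) where
  open GPTModel M
  open IsPreorder isPreorder using (refl; trans)
  open Persistence M

  R⁺ : Rel X (a ⊔ r ⊔ m)
  R⁺ = _≤_ ⨾ R

  S⁺ : Rel X (a ⊔ r ⊔ m)
  S⁺ = S ⨾ _≥_

  R⁺-cond : (R⁺ ⨾ _≤_) ⊆ʳ (_≤_ ⨾ R⁺)
  R⁺-cond {x} (w , (u , x≤u , uRw) , w≤y) with R-cond (w , uRw , w≤y)
  ... | u' , u≤u' , u'Ry = x , refl , u' , trans x≤u u≤u' , u'Ry

  S⁺-cond : (_≥_ ⨾ S⁺) ⊆ʳ (S⁺ ⨾ _≥_)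
  S⁺-cond {y = y} (u , u≤x , (w , uSw , y≤w)) with S-cond (u , u≤x , uSw)
  ... | u' , xSu' , w≤u' = y , (u' , xSu' , trans y≤w w≤u') , refl

  M⁺ : GPTModel a r v (a ⊔ r ⊔ m)
  M⁺ = withRelations M R⁺ S⁺ R⁺-cond S⁺-cond

  open GPTModel M⁺ using () renaming (_⊩_ to _⊩⁺_; StrictlyCondensed to M⁺-StrictlyCondensed)

  ≤-absorbˡ : ∀ {ℓ} {Z : Rel X ℓ} → (_≤_ ⨾ (_≤_ ⨾ Z)) ⊆ʳ (_≤_ ⨾ Z)
  ≤-absorbˡ (u , x≤u , w , u≤w , wZy) = w , trans x≤u u≤w , wZy

  M⁺-strictlyCondensed : M⁺-StrictlyCondensed
  M⁺-strictlyCondensed =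
      ≤-absorbˡ {Z = R}
    , λ { (u , x≤u , w , ySw , u≤w) → w , ySw , trans x≤u u≤w }

  ⊩⇒⊩⁺ : ∀ φ {x} → x ⊩ φ → x ⊩⁺ φ
  ⊩⁺⇒⊩ : ∀ φ {x} → x ⊩⁺ φ → x ⊩ φ

  ⊩⇒⊩⁺ (var p)  xp              = xp
  ⊩⇒⊩⁺ ⊤f       _               = _
  ⊩⇒⊩⁺ (φ ∧f ψ) (xφ , xψ)       = ⊩⇒⊩⁺ φ xφ , ⊩⇒⊩⁺ ψ xψ
  ⊩⇒⊩⁺ (φ ∨f ψ) (inj₁ xφ)       = inj₁ (⊩⇒⊩⁺ φ xφ)
  ⊩⇒⊩⁺ (φ ∨f ψ) (inj₂ xψ)       = inj₂ (⊩⇒⊩⁺ ψ xψ)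
  ⊩⇒⊩⁺ (φ ⇒f ψ) x⊩φ⇒ψ z x≤z zφ = ⊩⇒⊩⁺ ψ (x⊩φ⇒ψ z x≤z (⊩⁺⇒⊩ φ zφ))
  ⊩⇒⊩⁺ (φ −< ψ) (z , z≤x , zφ , z⊮ψ) = z , z≤x , ⊩⇒⊩⁺ φ zφ , λ zψ → z⊮ψ (⊩⁺⇒⊩ ψ zψ)
  ⊩⇒⊩⁺ (□f φ)   x□φ z x≤R⁺z     = ⊩⇒⊩⁺ φ (x□φ z (≤-absorbˡ {Z = R} x≤R⁺z))
  ⊩⇒⊩⁺ (□⁻ φ)   x□φ z (u , x≤u , w , zSw , u≤w) =
    ⊩⇒⊩⁺ φ (x□φ z (w , trans x≤u u≤w , zSw))
  ⊩⇒⊩⁺ (◇f φ)   (z , xSz , zφ)  = z , (z , xSz , refl) , ⊩⇒⊩⁺ φ zφ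
  ⊩⇒⊩⁺ (◇⁻ φ)   (z , zRx , zφ)  = z , (z , refl , zRx) , ⊩⇒⊩⁺ φ zφ

  ⊩⁺⇒⊩ (var p)  xp              = xp
  ⊩⁺⇒⊩ ⊤f       _               = _
  ⊩⁺⇒⊩ (φ ∧f ψ) (xφ , xψ)       = ⊩⁺⇒⊩ φ xφ , ⊩⁺⇒⊩ ψ xψ
  ⊩⁺⇒⊩ (φ ∨f ψ) (inj₁ xφ)       = inj₁ (⊩⁺⇒⊩ φ xφ)
  ⊩⁺⇒⊩ (φ ∨f ψ) (inj₂ xψ)       = inj₂ (⊩⁺⇒⊩ ψ xψ)
  ⊩⁺⇒⊩ (φ ⇒f ψ) x⊩φ⇒ψ z x≤z zφ = ⊩⁺⇒⊩ ψ (x⊩φ⇒ψ z x≤z (⊩⇒⊩⁺ φ zφ))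
  ⊩⁺⇒⊩ (φ −< ψ) (z , z≤x , zφ , z⊮ψ) = z , z≤x , ⊩⁺⇒⊩ φ zφ , λ zψ → z⊮ψ (⊩⇒⊩⁺ ψ zψ)
  ⊩⁺⇒⊩ (□f φ) {x} x□φ z x≤Rz   = ⊩⁺⇒⊩ φ (x□φ z (x , refl , x≤Rz))
  ⊩⁺⇒⊩ (□⁻ φ)  x□φ z (u , x≤u , zSu) = ⊩⁺⇒⊩ φ (x□φ z (u , x≤u , u , zSu , refl))
  ⊩⁺⇒⊩ (◇f φ)  (z , (w , xSw , z≤w) , zφ) = w , xSw , ⊩-upset φ z≤w (⊩⁺⇒⊩ φ zφ)
  ⊩⁺⇒⊩ (◇⁻ φ)  (z , (u , z≤u , uRx) , zφ) = u , uRx , ⊩-upset φ z≤u (⊩⁺⇒⊩ φ zφ)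

proposition6p14 : ∀ {a r v m : Level} (M : GPTModel a r v m) →
    Σ (Rel (GPTModel.X M) (a ⊔ r ⊔ m)) λ R⁺ →
    Σ (Rel (GPTModel.X M) (a ⊔ r ⊔ m)) λ S⁺ →
    Σ ((R⁺ ⨾ GPTModel._≤_ M) ⊆ʳ (GPTModel._≤_ M ⨾ R⁺)) λ Rc →
    Σ ((GPTModel._≥_ M ⨾ S⁺) ⊆ʳ (S⁺ ⨾ GPTModel._≥_ M)) λ Sc →
    GPTModel.StrictlyCondensed (withRelations M R⁺ S⁺ Rc Sc) ×
    (∀ x φ → (GPTModel._⊩_ M x φ) ⇔ (GPTModel._⊩_ (withRelations M R⁺ S⁺ Rc Sc) x φ))
proposition6p14 M =
  R⁺ , S⁺ , R⁺-cond , S⁺-cond , M⁺-strictlyCondensed , λ _ φ → mk⇔ (⊩⇒⊩⁺ φ) (⊩⁺⇒⊩ φ)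
  where open Condensation M
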